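{- Let $G=(V,E)$ be a simple cubic bipartite graph that has no potential 4-cycles, and let $F_1$ and $F_2$ be 2-factors of $G$ such that for every cycle $C$ of $(V,F_1)$ there exists a cycle $D$ of $(V,F_2)$ of size at least $10$ with $|V(C)\cap V(D)|\ge 4$. Then $(V,F_1)$ or $(V,F_2)$ has at most $|V|/8$ connected components.
   Context: A 2-factor of a graph $G=(V,E)$ is a set $F\subseteq E$ such that every node is incident to exactly two edges of $F$; each component of $(V,F)$ is a simple cycle. For a cycle $C$, $V(C)$ denotes its node set and its size is $|V(C)|=|E(C)|$. A set $S$ of 4 nodes is a potential 4-cycle if some 2-factor $F$ of $G$ has a cycle in $(V,F)$ with node set exactly $S$. -}

module Defs where

open import Data.Nat using (ℕ; zero; suc; _+_; _*_; _≤_)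
open import Data.Fin using (Fin)
open import Data.Bool using (Bool; true; false; if_then_else_)
open import Data.List using (List; map; allFin)
open import Data.Nat.ListAction using (sum)
open import Data.Product using (Σ; ∃; _×_; _,_)
open import Data.Sum using (_⊎_)
open import Relation.Binary.PropositionalEquality using (_≡_; _≢_)
open import Function.Definitions using (Injective)

-- A graph on the node set V = Fin n, given by a Boolean adjacency matrix.
-- Edge sets F ⊆ E are likewise symmetric Boolean matrices.
Rel : ℕ → Set
Rel n = Fin n → Fin n → Bool

count : {n : ℕ} → (Fin n → Bool) → ℕ
count {n} f = sum (map (λ y → if f y then 1 else 0) (allFin n))

degree : {n : ℕ} → Rel n → Fin n → ℕ
degree R x = count (R x)

Symmetric : {n : ℕ} → Rel n → Set
Symmetric R = ∀ x y → R x y ≡ R y x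

IsSimpleGraph : {n : ℕ} → Rel n → Set
IsSimpleGraph E = Symmetric E × (∀ x → E x x ≡ false)

IsCubic : {n : ℕ} → Rel n → Set
IsCubic E = ∀ x → degree E x ≡ 3

IsBipartite : {n : ℕ} → Rel n → Set
IsBipartite {n} E = Σ (Fin n → Bool) λ col → ∀ x y → E x y ≡ true → col x ≢ col y

SubsetOf : {n : ℕ} → Rel n → Rel n → Set
SubsetOf F E = ∀ x y → F x y ≡ true → E x y ≡ true

IsTwoFactor : {n : ℕ} → Rel n → Rel n → Set
IsTwoFactor E F = Symmetric F × SubsetOf F E × (∀ x → degree F x ≡ 2)

data Conn {n : ℕ} (F : Rel n) (u : Fin n) : Fin n → Set where
  here : Conn F u u
  step : ∀ {v w} → Conn F u v → F v w ≡ true → Conn F u w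

-- The component (cycle, since F is a 2-factor) of (V,F) containing v has
-- node set { w | Conn F v w }.
-- Its node set is exactly a 4-element set:
ComponentHasExactly4 : {n : ℕ} → Rel n → Fin n → Set
ComponentHasExactly4 {n} F v =
  Σ (Fin 4 → Fin n) λ a → Injective _≡_ _≡_ a ×
    (∀ i → Conn F v (a i)) × (∀ w → Conn F v w → ∃ λ i → a i ≡ w)

-- S is a potential 4-cycle for some S  <=>  some 2-factor has a 4-node cycle
HasPotential4Cycle : {n : ℕ} → Rel n → Set
HasPotential4Cycle {n} E =
  Σ (Rel n) λ F → IsTwoFactor E F × ∃ λ v → ComponentHasExactly4 F v

ComponentSize≥ : {n : ℕ} → Rel n → Fin n → ℕ → Set
ComponentSize≥ {n} F v k =
  Σ (Fin k → Fin n) λ a → Injective _≡_ _≡_ a × (∀ i → Conn F v (a i))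

IntersectionSize≥ : {n : ℕ} → Rel n → Fin n → Rel n → Fin n → ℕ → Set
IntersectionSize≥ {n} F u F' v k =
  Σ (Fin k → Fin n) λ a → Injective _≡_ _≡_ a ×
    (∀ i → Conn F u (a i) × Conn F' v (a i))

AtMostComponents : {n : ℕ} → Rel n → ℕ → Set
AtMostComponents {n} F m =
  Σ (Fin m → Fin n) λ r → ∀ w → ∃ λ i → Conn F (r i) w

-- (V,F) has at most |V|/8 components, i.e. c ≤ n/8 ⇔ 8·c ≤ n
AtMostEighthComponents : {n : ℕ} → Rel n → Set
AtMostEighthComponents {n} F = ∃ λ m → 8 * m ≤ n × AtMostComponents F m

-- Every cycle of a 2-factor of a bipartite graph without potential 4-cycles has at least 6 nodes:
-- walking two steps from a node in both directions either closes a square, which would be a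
-- potential 4-cycle, or yields six distinct nodes, as the colouring separates even and odd steps.
-- Now fix for each cycle C of F₁ a cycle D(C) of F₂ of size at least 10 and four nodes of C ∩ D(C).
-- If t cycles C have D(C) = D, their four-node sets are disjoint subsets of D, so |D| ≥ 4t, and
-- |D| ≥ 10 as soon as t ≥ 1; with |D| ≥ 6 this gives |D| ≥ 6 + 2t in every case. Summing over the
-- k₂ cycles of F₂ gives n ≥ 6 k₂ + 2 k₁, so k₁ and k₂ cannot both exceed n/8.
module Submission where

open import Data.Bool using (Bool; true; false; if_then_else_)
import Data.Bool.Properties as Boolₚ
import Data.Fin as Fin
open import Data.Fin using (Fin; zero; suc)
open import Data.Fin.Induction using (<-wellFounded)
open import Data.Fin.Properties using (_≟_; any?; all?; ¬∀⟶∃¬)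
import Data.Fin.Properties as Finₚ
open import Data.List using (List; []; _∷_; length; lookup; tabulate)
open import Data.List.Membership.Propositional using (_∈_)
open import Data.List.Membership.Propositional.Properties using (∈-lookup)
open import Data.List.Properties using (map-tabulate)
open import Data.List.Relation.Unary.All as All using (All; []; _∷_)
open import Data.List.Relation.Unary.AllPairs using ([]; _∷_)
open import Data.List.Relation.Unary.Any using (here; there; index)
open import Data.List.Relation.Unary.Any.Properties using (lookup-index)
open import Data.List.Relation.Unary.Unique.Propositional using (Unique)
open import Data.Nat using (ℕ; zero; suc; _+_; _*_; _≤_; _<_; z≤n; z<s; _≤?_)
import Data.Nat.ListAction as List
open import Data.Nat.Properties hiding (_≟_)
open import Data.Nat.Tactic.RingSolver using (solve-∀)
open import Data.Product using (Σ; ∃; _×_; _,_; proj₁; proj₂; map₂)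
open import Data.Sum as Sum using (_⊎_; inj₁; inj₂; [_,_]′)
import Data.Vec.Functional as Vector
open import Function using (_∘_; id; const)
open import Function.Definitions using (Injective)
import Induction.WellFounded as WF
open import Relation.Binary.PropositionalEquality
open import Relation.Nullary
  using (Dec; yes; no; does; ¬_; _×-dec_; _⊎-dec_; _→-dec_; ¬?; contradiction; map′)
open import Relation.Nullary.Decidable using (decidable-stable)
open import Relation.Unary using (Decidable)

open import Algebra.Properties.CommutativeMonoid.Sum +-0-commutativeMonoid
  using (sum-syntax; sum-cong-≗; ∑-comm; ∑-distrib-+)
open import Algebra.Properties.CommutativeSemigroup *-commutativeSemigroup using (x∙yz≈y∙xz)
open import Algebra.Properties.Semiring.Sum +-*-semiring using (*-distribˡ-sum)

open import Defs

private variable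
  m n : ℕ

-- Indicator sums

⟦_⟧ : ∀ {A : Set} → Dec A → ℕ
⟦ d ⟧ = if does d then 1 else 0

⟦⟧≤1 : ∀ {A : Set} (d : Dec A) → ⟦ d ⟧ ≤ 1
⟦⟧≤1 (yes _) = ≤-refl
⟦⟧≤1 (no _)  = z≤n

⟦⟧-pos : ∀ {A : Set} (d : Dec A) → 0 < ⟦ d ⟧ → A
⟦⟧-pos (yes a) _ = a

⟦⟧*-pos : ∀ {A : Set} (d : Dec A) {x : ℕ} → 0 < ⟦ d ⟧ * x → A × 0 < x
⟦⟧*-pos (yes a) {x} p = a , subst (0 <_) (+-identityʳ x) p

⟦⟧-yes : ∀ {A : Set} (d : Dec A) → A → ⟦ d ⟧ ≡ 1
⟦⟧-yes (yes _) _ = refl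
⟦⟧-yes (no ¬a) a = contradiction a ¬a

⟦⟧-mono : ∀ {A B : Set} (a? : Dec A) (b? : Dec B) → (A → B) → ⟦ a? ⟧ ≤ ⟦ b? ⟧
⟦⟧-mono (yes a) (yes _) _   = ≤-refl
⟦⟧-mono (yes a) (no ¬b) A→B = contradiction (A→B a) ¬b
⟦⟧-mono (no _)  _       _   = z≤n

∑-mono-≤ : {f g : Fin n → ℕ} → (∀ i → f i ≤ g i) → ∑[ i < n ] f i ≤ ∑[ i < n ] g i
∑-mono-≤ {zero}  _   = z≤n
∑-mono-≤ {suc n} f≤g = +-mono-≤ (f≤g zero) (∑-mono-≤ (f≤g ∘ suc))

∑-mono-< : {f g : Fin n → ℕ} → (∀ i → f i ≤ g i) → ∀ j → f j < g j →
           ∑[ i < n ] f i < ∑[ i < n ] g i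
∑-mono-< {suc n} f≤g zero    fj<gj = +-mono-<-≤ fj<gj (∑-mono-≤ (f≤g ∘ suc))
∑-mono-< {suc n} f≤g (suc j) fj<gj = +-mono-≤-< (f≤g zero) (∑-mono-< (f≤g ∘ suc) j fj<gj)

∑-const : ∀ m c → ∑[ i < m ] c ≡ m * c
∑-const zero    c = refl
∑-const (suc m) c = cong (c +_) (∑-const m c)

∑-zero : {f : Fin n → ℕ} → (∀ i → f i ≡ 0) → ∑[ i < n ] f i ≡ 0
∑-zero {zero}  _   = refl
∑-zero {suc n} f≡0 = cong₂ _+_ (f≡0 zero) (∑-zero (f≡0 ∘ suc))

term≤∑ : (f : Fin n → ℕ) (i : Fin n) → f i ≤ ∑[ j < n ] f j
term≤∑ f zero    = m≤m+n _ _
term≤∑ f (suc i) = ≤-trans (term≤∑ (f ∘ suc) i) (m≤n+m _ (f zero))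

∑-pos : (f : Fin n → ℕ) → 0 < ∑[ i < n ] f i → ∃ λ i → 0 < f i
∑-pos {suc n} f 0<∑ with f zero in eq
... | suc _ = zero , subst (0 <_) (sym eq) z<s
... | zero  with ∑-pos (f ∘ suc) 0<∑
...   | i , 0<fi = suc i , 0<fi

∑-≤1 : {f : Fin n → ℕ} → (∀ i → f i ≤ 1) → (∀ i j → 0 < f i → 0 < f j → i ≡ j) →
       ∑[ i < n ] f i ≤ 1
∑-≤1 {zero}          _   _    = z≤n
∑-≤1 {suc n} {f} f≤1 uniq with f zero in eq
... | zero  = ∑-≤1 (f≤1 ∘ suc) (λ i j p q → Finₚ.suc-injective (uniq (suc i) (suc j) p q))
... | suc k = begin
  suc k + ∑[ i < n ] f (suc i)  ≡⟨ cong (suc k +_) (∑-zero tail≡0) ⟩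
  suc k + 0                     ≡⟨ +-identityʳ (suc k) ⟩
  suc k                         ≡⟨ eq ⟨
  f zero                        ≤⟨ f≤1 zero ⟩
  1                             ∎
  where
  open ≤-Reasoning
  tail≡0 : ∀ i → f (suc i) ≡ 0
  tail≡0 i = n≤0⇒n≡0 (≮⇒≥ λ 0<fi → Finₚ.0≢1+n (uniq zero (suc i) (subst (0 <_) (sym eq) z<s) 0<fi))

∑-delta : (a : Fin n) (g : Fin n → ℕ) → ∑[ v < n ] (⟦ a ≟ v ⟧ * g v) ≡ g a
∑-delta {suc n} zero    g =
  trans (cong₂ _+_ (+-identityʳ (g zero)) (∑-zero {n} (λ _ → refl))) (+-identityʳ (g zero))
∑-delta {suc n} (suc a) g = ∑-delta a (g ∘ suc)

∑-comm-weighted : (α : Fin m → ℕ) (β : Fin n → ℕ) (γ : Fin m → Fin n → ℕ) →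
           ∑[ x < m ] (α x * ∑[ y < n ] (β y * γ x y)) ≡ ∑[ y < n ] (β y * ∑[ x < m ] (α x * γ x y))
∑-comm-weighted {m} {n} α β γ = begin
  ∑[ x < m ] (α x * ∑[ y < n ] (β y * γ x y))
    ≡⟨ sum-cong-≗ {m} (λ x → *-distribˡ-sum (α x) (λ y → β y * γ x y)) ⟩
  ∑[ x < m ] ∑[ y < n ] (α x * (β y * γ x y))
    ≡⟨ ∑-comm (λ x y → α x * (β y * γ x y)) ⟩
  ∑[ y < n ] ∑[ x < m ] (α x * (β y * γ x y))
    ≡⟨ sum-cong-≗ {n} (λ y → sum-cong-≗ {m} (λ x → x∙yz≈y∙xz (α x) (β y) (γ x y))) ⟩
  ∑[ y < n ] ∑[ x < m ] (β y * (α x * γ x y))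
    ≡⟨ sum-cong-≗ {n} (λ y → *-distribˡ-sum (β y) (λ x → α x * γ x y)) ⟨
  ∑[ y < n ] (β y * ∑[ x < m ] (α x * γ x y))
    ∎
  where open ≡-Reasoning

multiplicity : (Fin m → Fin n) → Fin n → ℕ
multiplicity {m} f v = ∑[ i < m ] ⟦ f i ≟ v ⟧

∑-*-multiplicity : (f : Fin m → Fin n) (g : Fin n → ℕ) →
                   ∑[ v < n ] (g v * multiplicity f v) ≡ ∑[ i < m ] g (f i)
∑-*-multiplicity {m} {n} f g = begin
  ∑[ v < n ] (g v * ∑[ i < m ] ⟦ f i ≟ v ⟧)
    ≡⟨ sum-cong-≗ {n} (λ v → *-distribˡ-sum (g v) (λ i → ⟦ f i ≟ v ⟧)) ⟩
  ∑[ v < n ] ∑[ i < m ] (g v * ⟦ f i ≟ v ⟧)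
    ≡⟨ ∑-comm (λ v i → g v * ⟦ f i ≟ v ⟧) ⟩
  ∑[ i < m ] ∑[ v < n ] (g v * ⟦ f i ≟ v ⟧)
    ≡⟨ sum-cong-≗ {m} (λ i → sum-cong-≗ {n} (λ v → *-comm (g v) _)) ⟩
  ∑[ i < m ] ∑[ v < n ] (⟦ f i ≟ v ⟧ * g v)
    ≡⟨ sum-cong-≗ {m} (λ i → ∑-delta (f i) g) ⟩
  ∑[ i < m ] g (f i)
    ∎
  where open ≡-Reasoning

multiplicity≤1 : {f : Fin m → Fin n} → Injective _≡_ _≡_ f → ∀ v → multiplicity f v ≤ 1
multiplicity≤1 {f = f} f-inj v = ∑-≤1 (λ i → ⟦⟧≤1 (f i ≟ v)) λ i j fᵢ≡v fⱼ≡v →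
  f-inj (trans (⟦⟧-pos (f i ≟ v) fᵢ≡v) (sym (⟦⟧-pos (f j ≟ v) fⱼ≡v)))

multiplicity-pos : (f : Fin m → Fin n) {v : Fin n} → 0 < multiplicity f v → ∃ λ i → f i ≡ v
multiplicity-pos f {v} 0<mult with ∑-pos (λ i → ⟦ f i ≟ v ⟧) 0<mult
... | i , 0<δ = i , ⟦⟧-pos (f i ≟ v) 0<δ

-- Sizes of decidable subsets of Fin n

size : {P : Fin n → Set} → Decidable P → ℕ
size {n} P? = ∑[ v < n ] ⟦ P? v ⟧

size≤n : {P : Fin n → Set} (P? : Decidable P) → size P? ≤ n
size≤n {n} P? = begin
  size P?                ≤⟨ ∑-mono-≤ (λ v → ⟦⟧≤1 (P? v)) ⟩
  ∑[ v < n ] 1           ≡⟨ ∑-const n 1 ⟩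
  n * 1                  ≡⟨ *-identityʳ n ⟩
  n                      ∎
  where open ≤-Reasoning

injective⇒≤size : {P : Fin n → Set} (P? : Decidable P) {f : Fin m → Fin n} →
                  Injective _≡_ _≡_ f → (∀ i → P (f i)) → m ≤ size P?
injective⇒≤size {n} {m} P? {f} f-inj f∈P = begin
  m                                         ≡⟨ *-identityʳ m ⟨
  m * 1                                     ≡⟨ ∑-const m 1 ⟨
  ∑[ i < m ] 1                              ≡⟨ sum-cong-≗ {m} (λ i → ⟦⟧-yes (P? (f i)) (f∈P i)) ⟨
  ∑[ i < m ] ⟦ P? (f i) ⟧                   ≡⟨ ∑-*-multiplicity f (λ v → ⟦ P? v ⟧) ⟨
  ∑[ v < n ] (⟦ P? v ⟧ * multiplicity f v)
    ≤⟨ ∑-mono-≤ (λ v → *-monoʳ-≤ ⟦ P? v ⟧ (multiplicity≤1 f-inj v)) ⟩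
  ∑[ v < n ] (⟦ P? v ⟧ * 1)                 ≡⟨ sum-cong-≗ {n} (λ v → *-identityʳ ⟦ P? v ⟧) ⟩
  size P?                                   ∎
  where open ≤-Reasoning

nonempty⇒size-pos : {P : Fin n → Set} (P? : Decidable P) {c : Fin n} → P c → 0 < size P?
nonempty⇒size-pos P? {c} Pc =
  ≤-trans (≤-reflexive (sym (⟦⟧-yes (P? c) Pc))) (term≤∑ (λ v → ⟦ P? v ⟧) c)

size-pos⇒nonempty : {P : Fin n → Set} (P? : Decidable P) → 0 < size P? → ∃ P
size-pos⇒nonempty P? 0<size with ∑-pos (λ v → ⟦ P? v ⟧) 0<size
... | c , 0<δ = c , ⟦⟧-pos (P? c) 0<δ

remove : {P : Fin n → Set} → Decidable P → (y : Fin n) → Decidable (λ c → P c × y ≢ c)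
remove P? y c = P? c ×-dec ¬? (y ≟ c)

size-remove : {P : Fin n → Set} (P? : Decidable P) {y : Fin n} → P y →
              size P? ≡ suc (size (remove P? y))
size-remove {n} P? {y} Py = begin
  size P?
    ≡⟨ sum-cong-≗ {n} split ⟩
  ∑[ c < n ] (⟦ y ≟ c ⟧ * ⟦ P? c ⟧ + ⟦ remove P? y c ⟧)
    ≡⟨ ∑-distrib-+ (λ c → ⟦ y ≟ c ⟧ * ⟦ P? c ⟧) _ ⟩
  ∑[ c < n ] (⟦ y ≟ c ⟧ * ⟦ P? c ⟧) + size (remove P? y)
    ≡⟨ cong (_+ size (remove P? y)) (trans (∑-delta y (λ c → ⟦ P? c ⟧)) (⟦⟧-yes (P? y) Py)) ⟩
  suc (size (remove P? y))
    ∎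
  where
  open ≡-Reasoning
  split : ∀ c → ⟦ P? c ⟧ ≡ ⟦ y ≟ c ⟧ * ⟦ P? c ⟧ + ⟦ remove P? y c ⟧
  split c with P? c | y ≟ c
  ... | yes _ | yes _ = refl
  ... | yes _ | no  _ = refl
  ... | no  _ | yes _ = refl
  ... | no  _ | no  _ = refl

size≡1⇒singleton : {P : Fin n → Set} (P? : Decidable P) → size P? ≡ 1 →
                   ∃ λ z → P z × ∀ c → P c → c ≡ z
size≡1⇒singleton {P = P} P? size≡1 with size-pos⇒nonempty P? (≤-reflexive (sym size≡1))
... | z , Pz = z , Pz , only-z
  where
  only-z : ∀ c → P c → c ≡ z
  only-z c Pc with z ≟ c
  ... | yes z≡c = sym z≡c
  ... | no  z≢c = contradiction (nonempty⇒size-pos (remove P? z) (Pc , z≢c))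
                    (≤⇒≯ (≤-reflexive (suc-injective (trans (sym (size-remove P? Pz)) size≡1))))

size≡2⇒pair : {P : Fin n → Set} (P? : Decidable P) → size P? ≡ 2 → ∀ {y} → P y →
              ∃ λ z → P z × y ≢ z × ∀ c → P c → c ≡ y ⊎ c ≡ z
size≡2⇒pair {P = P} P? size≡2 {y} Py
  with size≡1⇒singleton (remove P? y) (suc-injective (trans (sym (size-remove P? Py)) size≡2))
... | z , (Pz , y≢z) , only-z = z , Pz , y≢z , y-or-z
  where
  y-or-z : ∀ c → P c → c ≡ y ⊎ c ≡ z
  y-or-z c Pc with y ≟ c
  ... | yes y≡c = inj₁ (sym y≡c)
  ... | no  y≢c = inj₂ (only-z c (Pc , y≢c))

enumerate : {P : Fin n → Set} (P? : Decidable P) →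
            Σ (Fin (size P?) → Fin n) λ e → ∀ x → P x → ∃ λ i → e i ≡ x
enumerate {zero}  P? = (λ ()) , λ ()
enumerate {suc n} P? with P? zero | enumerate (P? ∘ suc)
... | yes _   | e , e-onto = zero Vector.∷ (suc ∘ e) , λ where
  zero    _  → zero , refl
  (suc x) Px → let i , eᵢ≡x = e-onto x Px in suc i , cong suc eᵢ≡x
... | no ¬P₀ | e , e-onto = suc ∘ e , λ where
  zero    P₀ → contradiction P₀ ¬P₀
  (suc x) Px → map₂ (cong suc) (e-onto x Px)

isTrue? : (b : Bool) → Dec (b ≡ true)
isTrue? b = b Boolₚ.≟ true

count≡size : (b : Fin n → Bool) → count b ≡ size (λ y → isTrue? (b y))
count≡size {n} b = begin
  count b                      ≡⟨ cong List.sum (map-tabulate id term) ⟩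
  List.sum (tabulate term)     ≡⟨ sum-tabulate term ⟩
  ∑[ y < n ] term y            ≡⟨ sum-cong-≗ {n} (λ y → if≡⟦isTrue?⟧ (b y)) ⟩
  size (λ y → isTrue? (b y))   ∎
  where
  open ≡-Reasoning
  term : Fin n → ℕ
  term y = if b y then 1 else 0
  if≡⟦isTrue?⟧ : ∀ c → (if c then 1 else 0) ≡ ⟦ isTrue? c ⟧
  if≡⟦isTrue?⟧ true  = refl
  if≡⟦isTrue?⟧ false = refl
  sum-tabulate : ∀ {m} (f : Fin m → ℕ) → List.sum (tabulate f) ≡ ∑[ i < m ] f i
  sum-tabulate {zero}  f = refl
  sum-tabulate {suc m} f = cong (f zero +_) (sum-tabulate (f ∘ suc))

size-mono : {P Q : Fin n → Set} (P? : Decidable P) (Q? : Decidable Q) →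
            (∀ {v} → P v → Q v) → size P? ≤ size Q?
size-mono P? Q? P⊆Q = ∑-mono-≤ (λ v → ⟦⟧-mono (P? v) (Q? v) P⊆Q)

size-mono-< : {P Q : Fin n → Set} (P? : Decidable P) (Q? : Decidable Q) →
              (∀ {v} → P v → Q v) → ∀ {w} → Q w → ¬ P w → size P? < size Q?
size-mono-< P? Q? P⊆Q {w} Qw ¬Pw = ∑-mono-< (λ v → ⟦⟧-mono (P? v) (Q? v) P⊆Q) w strict
  where
  strict : ⟦ P? w ⟧ < ⟦ Q? w ⟧
  strict with P? w | Q? w
  ... | yes Pw | _      = contradiction Pw ¬Pw
  ... | no _   | yes _  = z<s
  ... | no _   | no ¬Qw = contradiction Qw ¬Qw

lookup-injective : {A : Set} {xs : List A} → Unique xs → Injective _≡_ _≡_ (lookup xs)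
lookup-injective {xs = x ∷ xs} _ {zero} {zero} _ = refl
lookup-injective {xs = x ∷ xs} (x∉xs ∷ _) {zero} {suc j} x≡xⱼ =
  contradiction x≡xⱼ (All.lookup x∉xs (∈-lookup j))
lookup-injective {xs = x ∷ xs} (x∉xs ∷ _) {suc i} {zero} xᵢ≡x =
  contradiction (sym xᵢ≡x) (All.lookup x∉xs (∈-lookup i))
lookup-injective {xs = x ∷ xs} (_ ∷ xs-unique) {suc i} {suc j} xᵢ≡xⱼ =
  cong suc (lookup-injective xs-unique xᵢ≡xⱼ)

unique⇒≤size : {P : Fin n → Set} (P? : Decidable P) {xs : List (Fin n)} → Unique xs → All P xs →
               length xs ≤ size P?
unique⇒≤size P? xs-unique xs⊆P =
  injective⇒≤size P? (lookup-injective xs-unique) (λ i → All.lookup xs⊆P (∈-lookup i))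

-- Connected components

ascending-chain-stabilises : (P : ℕ → Fin n → Set) (P? : ∀ k → Decidable (P k)) →
                             (∀ k {v} → P k v → P (suc k) v) → ∃ λ k → ∀ {v} → P (suc k) v → P k v
ascending-chain-stabilises {n} P P? grow =
  [ id , (λ n<size → contradiction (size≤n (P? (suc n))) (<⇒≱ n<size)) ]′ (bound (suc n))
  where
  Stable : ℕ → Set
  Stable k = ∀ {v} → P (suc k) v → P k v
  bound : ∀ k → ∃ Stable ⊎ k ≤ size (P? k)
  bound zero = inj₂ z≤n
  bound (suc k) with bound k
  ... | inj₁ stable = inj₁ stable
  ... | inj₂ k≤size with all? (λ v → P? (suc k) v →-dec P? k v)
  ...   | yes shrinks = inj₁ (k , shrinks _)
  ...   | no ¬shrinks with ¬∀⟶∃¬ n _ (λ v → P? (suc k) v →-dec P? k v) ¬shrinks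
  ...     | v , ¬shrink =
    inj₂ (≤-<-trans k≤size (size-mono-< (P? k) (P? (suc k)) (grow k) new (¬shrink ∘ const)))
    where
    new : P (suc k) v
    new = decidable-stable (P? (suc k) v) (λ ¬new → ¬shrink (λ new → contradiction new ¬new))

Conn-trans : {F : Rel n} {u v w : Fin n} → Conn F u v → Conn F v w → Conn F u w
Conn-trans c here         = c
Conn-trans c (step d Fvw) = step (Conn-trans c d) Fvw

Conn-sym : {F : Rel n} → Symmetric F → {u v : Fin n} → Conn F u v → Conn F v u
Conn-sym F-sym here = here
Conn-sym F-sym (step {v} {w} c Fvw) =
  Conn-trans (step here (trans (F-sym w v) Fvw)) (Conn-sym F-sym c)

Conn-closed : {F : Rel n} (S : Fin n → Set) {v : Fin n} → S v →
              (∀ {x y} → S x → F x y ≡ true → S y) → ∀ {w} → Conn F v w → S w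
Conn-closed S Sv closed here         = Sv
Conn-closed S Sv closed (step c Fxy) = closed (Conn-closed S Sv closed c) Fxy

module Reachability {n : ℕ} (F : Rel n) where

  ReachableWithin : Fin n → ℕ → Fin n → Set
  ReachableWithin u zero    w = u ≡ w
  ReachableWithin u (suc k) w =
    ReachableWithin u k w ⊎ ∃ λ v → ReachableWithin u k v × F v w ≡ true

  reachableWithin? : ∀ u k → Decidable (ReachableWithin u k)
  reachableWithin? u zero    w = u ≟ w
  reachableWithin? u (suc k) w =
    reachableWithin? u k w ⊎-dec any? (λ v → reachableWithin? u k v ×-dec isTrue? (F v w))

  reachableWithin-start : ∀ u k → ReachableWithin u k u
  reachableWithin-start u zero    = refl
  reachableWithin-start u (suc k) = inj₁ (reachableWithin-start u k)

  reachableWithin⇒Conn : ∀ {u} k {w} → ReachableWithin u k w → Conn F u w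
  reachableWithin⇒Conn zero    refl                = here
  reachableWithin⇒Conn (suc k) (inj₁ r)           = reachableWithin⇒Conn k r
  reachableWithin⇒Conn (suc k) (inj₂ (_ , r , Fvw)) = step (reachableWithin⇒Conn k r) Fvw

  Conn? : ∀ u → Decidable (Conn F u)
  Conn? u with ascending-chain-stabilises (ReachableWithin u) (reachableWithin? u) (λ _ → inj₁)
  ... | k , stable = λ w → map′ (reachableWithin⇒Conn k) reachable (reachableWithin? u k w)
    where
    reachable : ∀ {w} → Conn F u w → ReachableWithin u k w
    reachable here         = reachableWithin-start u k
    reachable (step c Fvw) = stable (inj₂ (_ , reachable c , Fvw))

module Components {n : ℕ} (F : Rel n) (F-sym : Symmetric F) where

  open Reachability F public using (Conn?)

  Leader : Fin n → Set
  Leader r = ∀ w → Conn F r w → r Fin.≤ w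

  leader? : Decidable Leader
  leader? r = all? (λ w → Conn? r w →-dec r Finₚ.≤? w)

  leader-unique : ∀ {r r′} → Leader r → Leader r′ → Conn F r r′ → r ≡ r′
  leader-unique Lr Lr′ c = Finₚ.≤-antisym (Lr _ c) (Lr′ _ (Conn-sym F-sym c))

  leader-exists : ∀ w → ∃ λ r → Leader r × Conn F r w
  leader-exists = WF.All.wfRec <-wellFounded _ _ go
    where
    go : ∀ w → (∀ {x} → x Fin.< w → ∃ λ r → Leader r × Conn F r x) →
         ∃ λ r → Leader r × Conn F r w
    go w rec with leader? w
    ... | yes Lw = w , Lw , here
    ... | no ¬Lw with ¬∀⟶∃¬ n _ (λ x → Conn? w x →-dec w Finₚ.≤? x) ¬Lw
    ...   | x , ¬w≤x with rec (≰⇒> (¬w≤x ∘ const))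
    ...     | r , Lr , Crx = r , Lr , Conn-trans Crx (Conn-sym F-sym Cwx)
      where
      Cwx : Conn F w x
      Cwx = decidable-stable (Conn? w x) (λ ¬Cwx → ¬w≤x (λ Cwx → contradiction Cwx ¬Cwx))

  #components : ℕ
  #components = size leader?

  atMostComponents : AtMostComponents F #components
  atMostComponents with enumerate leader?
  ... | e , e-onto = e , covered
    where
    covered : ∀ w → ∃ λ i → Conn F (e i) w
    covered w with leader-exists w
    ... | r , Lr , Crw with e-onto r Lr
    ...   | i , eᵢ≡r = i , subst (λ x → Conn F x w) (sym eᵢ≡r) Crw

  Conn?-resp : ∀ r {x y} → Conn F x y → ⟦ Conn? r x ⟧ ≡ ⟦ Conn? r y ⟧
  Conn?-resp r {x} {y} Cxy = ≤-antisym
    (⟦⟧-mono (Conn? r x) (Conn? r y) (λ Crx → Conn-trans Crx Cxy))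
    (⟦⟧-mono (Conn? r y) (Conn? r x) (λ Cry → Conn-trans Cry (Conn-sym F-sym Cxy)))

  one-leader : ∀ v → ∑[ r < n ] (⟦ leader? r ⟧ * ⟦ Conn? r v ⟧) ≡ 1
  one-leader v with leader-exists v
  ... | r₀ , Lr₀ , Cr₀v = ≤-antisym at-most-one at-least-one
    where
    term : Fin n → ℕ
    term r = ⟦ leader? r ⟧ * ⟦ Conn? r v ⟧
    unique : ∀ r r′ → 0 < term r → 0 < term r′ → r ≡ r′
    unique r r′ p p′ with ⟦⟧*-pos (leader? r) p | ⟦⟧*-pos (leader? r′) p′
    ... | Lr , q | Lr′ , q′ = leader-unique Lr Lr′
      (Conn-trans (⟦⟧-pos (Conn? r v) q) (Conn-sym F-sym (⟦⟧-pos (Conn? r′ v) q′)))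
    at-most-one : ∑[ r < n ] term r ≤ 1
    at-most-one = ∑-≤1 (λ r → *-mono-≤ (⟦⟧≤1 (leader? r)) (⟦⟧≤1 (Conn? r v))) unique
    at-least-one : 1 ≤ ∑[ r < n ] term r
    at-least-one = subst (_≤ ∑[ r < n ] term r)
      (cong₂ _*_ (⟦⟧-yes (leader? r₀) Lr₀) (⟦⟧-yes (Conn? r₀ v) Cr₀v)) (term≤∑ term r₀)

  ∑-component-sizes : ∑[ r < n ] (⟦ leader? r ⟧ * size (Conn? r)) ≡ n
  ∑-component-sizes = begin
    ∑[ r < n ] (⟦ leader? r ⟧ * size (Conn? r))
      ≡⟨ sum-cong-≗ {n} (λ r → cong (⟦ leader? r ⟧ *_) (sum-cong-≗ {n} (λ v → *-identityˡ _))) ⟨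
    ∑[ r < n ] (⟦ leader? r ⟧ * ∑[ v < n ] (1 * ⟦ Conn? r v ⟧))
      ≡⟨ ∑-comm-weighted (λ r → ⟦ leader? r ⟧) (λ _ → 1) (λ r v → ⟦ Conn? r v ⟧) ⟩
    ∑[ v < n ] (1 * ∑[ r < n ] (⟦ leader? r ⟧ * ⟦ Conn? r v ⟧))
      ≡⟨ sum-cong-≗ {n} (λ v → cong (1 *_) (one-leader v)) ⟩
    ∑[ v < n ] 1
      ≡⟨ ∑-const n 1 ⟩
    n * 1
      ≡⟨ *-identityʳ n ⟩
    n ∎
    where open ≡-Reasoning

-- Cycles of 2-factors of bipartite graphs

module TwoFactor {n : ℕ} {E F : Rel n} (E-loopless : ∀ x → E x x ≡ false)
                 (bipartite : IsBipartite E) (F-twoFactor : IsTwoFactor E F) where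

  open Reachability F using (Conn?)

  private
    colour : Fin n → Bool
    colour = proj₁ bipartite
    F-sym : Symmetric F
    F-sym = proj₁ F-twoFactor
    F⊆E : SubsetOf F E
    F⊆E = proj₁ (proj₂ F-twoFactor)
    F-degree : ∀ x → degree F x ≡ 2
    F-degree = proj₂ (proj₂ F-twoFactor)

  F-irreflexive : ∀ {x y} → F x y ≡ true → x ≢ y
  F-irreflexive {x} Fxy refl = contradiction (trans (sym (F⊆E x x Fxy)) (E-loopless x)) λ ()

  F-colours-differ : ∀ {x y} → F x y ≡ true → colour x ≢ colour y
  F-colours-differ {x} {y} Fxy = proj₂ bipartite x y (F⊆E x y Fxy)

  F-flip : ∀ {x y} → F x y ≡ true → F y x ≡ true
  F-flip {x} {y} Fxy = trans (F-sym y x) Fxy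

  same-colour : ∀ {x y z} → F x y ≡ true → F y z ≡ true → colour x ≡ colour z
  same-colour Fxy Fyz =
    trans (Boolₚ.¬-not (F-colours-differ Fxy)) (sym (Boolₚ.¬-not (F-colours-differ Fyz ∘ sym)))

  some-neighbour : ∀ x → ∃ λ y → F x y ≡ true
  some-neighbour x = size-pos⇒nonempty (λ y → isTrue? (F x y))
    (subst (0 <_) (trans (sym (F-degree x)) (count≡size (F x))) z<s)

  other-neighbour : ∀ {x y} → F x y ≡ true →
                    ∃ λ z → F x z ≡ true × y ≢ z × ∀ c → F x c ≡ true → c ≡ y ⊎ c ≡ z
  other-neighbour {x} =
    size≡2⇒pair (λ y → isTrue? (F x y)) (trans (sym (count≡size (F x))) (F-degree x))

  neighbours-between : ∀ {x y z} → F x y ≡ true → F x z ≡ true → y ≢ z →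
                       ∀ c → F x c ≡ true → c ≡ y ⊎ c ≡ z
  neighbours-between Fxy Fxz y≢z c Fxc with other-neighbour Fxy
  ... | z′ , _ , _ , y-or-z′ with y-or-z′ c Fxc | y-or-z′ _ Fxz
  ...   | inj₁ c≡y  | _         = inj₁ c≡y
  ...   | inj₂ _    | inj₁ z≡y  = contradiction (sym z≡y) y≢z
  ...   | inj₂ c≡z′ | inj₂ z≡z′ = inj₂ (trans c≡z′ (sym z≡z′))

  square⇒potential4Cycle : ∀ {v x₁ y₁ x₂} → F v x₁ ≡ true → F v y₁ ≡ true →
                           F x₁ x₂ ≡ true → F y₁ x₂ ≡ true → x₁ ≢ y₁ → v ≢ x₂ →
                           HasPotential4Cycle E
  square⇒potential4Cycle {v} {x₁} {y₁} {x₂} Fvx₁ Fvy₁ Fx₁x₂ Fy₁x₂ x₁≢y₁ v≢x₂ =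
    F , F-twoFactor , v , lookup square , lookup-injective distinct ,
    (λ i → All.lookup path (∈-lookup i)) ,
    (λ w Cvw → let w∈square = Conn-closed (_∈ square) v∈ closed Cvw in
               index w∈square , sym (lookup-index w∈square))
    where
    square : List (Fin n)
    square = v ∷ x₁ ∷ y₁ ∷ x₂ ∷ []
    distinct : Unique square
    distinct = (F-irreflexive Fvx₁ ∷ F-irreflexive Fvy₁ ∷ v≢x₂ ∷ [])
             ∷ (x₁≢y₁ ∷ F-irreflexive Fx₁x₂ ∷ [])
             ∷ (F-irreflexive Fy₁x₂ ∷ [])
             ∷ [] ∷ []
    path : All (Conn F v) square
    path = here ∷ step here Fvx₁ ∷ step here Fvy₁ ∷ step (step here Fvx₁) Fx₁x₂ ∷ []
    v∈ : v ∈ square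
    v∈ = here refl
    x₁∈ : x₁ ∈ square
    x₁∈ = there (here refl)
    y₁∈ : y₁ ∈ square
    y₁∈ = there (there (here refl))
    x₂∈ : x₂ ∈ square
    x₂∈ = there (there (there (here refl)))
    one-of : ∀ {a b c} → a ∈ square → b ∈ square → c ≡ a ⊎ c ≡ b → c ∈ square
    one-of a∈ b∈ = [ (λ { refl → a∈ }) , (λ { refl → b∈ }) ]′
    closed : ∀ {x y} → x ∈ square → F x y ≡ true → y ∈ square
    closed (here refl) Fvy =
      one-of x₁∈ y₁∈ (neighbours-between Fvx₁ Fvy₁ x₁≢y₁ _ Fvy)
    closed (there (here refl)) Fx₁y =
      one-of v∈ x₂∈ (neighbours-between (F-flip Fvx₁) Fx₁x₂ v≢x₂ _ Fx₁y)
    closed (there (there (here refl))) Fy₁y =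
      one-of v∈ x₂∈ (neighbours-between (F-flip Fvy₁) Fy₁x₂ v≢x₂ _ Fy₁y)
    closed (there (there (there (here refl)))) Fx₂y =
      one-of x₁∈ y₁∈ (neighbours-between (F-flip Fx₁x₂) (F-flip Fy₁x₂) x₁≢y₁ _ Fx₂y)

  component-size≥6 : ¬ HasPotential4Cycle E → ∀ v → 6 ≤ size (Conn? v)
  component-size≥6 no-square v with some-neighbour v
  ... | x₁ , Fvx₁ with other-neighbour Fvx₁
  ... | y₁ , Fvy₁ , x₁≢y₁ , _ with other-neighbour (F-flip Fvx₁) | other-neighbour (F-flip Fvy₁)
  ... | x₂ , Fx₁x₂ , v≢x₂ , _ | y₂ , Fy₁y₂ , v≢y₂ , N[y₁] with x₂ ≟ y₂
  ... | yes refl = contradiction (square⇒potential4Cycle Fvx₁ Fvy₁ Fx₁x₂ Fy₁y₂ x₁≢y₁ v≢x₂) no-square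
  ... | no x₂≢y₂ with other-neighbour (F-flip Fx₁x₂)
  ... | x₃ , Fx₂x₃ , x₁≢x₃ , _ = unique⇒≤size (Conn? v) distinct path
    where
    hexagon : List (Fin n)
    hexagon = v ∷ x₂ ∷ y₂ ∷ x₁ ∷ y₁ ∷ x₃ ∷ []
    path : All (Conn F v) hexagon
    path = here ∷ step (step here Fvx₁) Fx₁x₂ ∷ step (step here Fvy₁) Fy₁y₂
         ∷ step here Fvx₁ ∷ step here Fvy₁ ∷ step (step (step here Fvx₁) Fx₁x₂) Fx₂x₃ ∷ []
    x₂∼v : colour x₂ ≡ colour v
    x₂∼v = sym (same-colour Fvx₁ Fx₁x₂)
    y₂∼v : colour y₂ ≡ colour v
    y₂∼v = sym (same-colour Fvy₁ Fy₁y₂)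
    opposite : ∀ {a b} → colour a ≡ colour v → colour b ≢ colour v → a ≢ b
    opposite a∼v b≁v refl = b≁v a∼v
    x₁≁v : colour x₁ ≢ colour v
    x₁≁v = F-colours-differ Fvx₁ ∘ sym
    y₁≁v : colour y₁ ≢ colour v
    y₁≁v = F-colours-differ Fvy₁ ∘ sym
    x₃≁v : colour x₃ ≢ colour v
    x₃≁v x₃∼v = F-colours-differ Fx₂x₃ (trans x₂∼v (sym x₃∼v))
    y₁≢x₃ : y₁ ≢ x₃
    y₁≢x₃ refl = [ v≢x₂ ∘ sym , x₂≢y₂ ]′ (N[y₁] x₂ (F-flip Fx₂x₃))
    distinct : Unique hexagon
    distinct = (v≢x₂ ∷ v≢y₂ ∷ F-irreflexive Fvx₁ ∷ F-irreflexive Fvy₁ ∷ opposite refl x₃≁v ∷ [])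
             ∷ (x₂≢y₂ ∷ F-irreflexive (F-flip Fx₁x₂) ∷ opposite x₂∼v y₁≁v ∷ F-irreflexive Fx₂x₃
                 ∷ [])
             ∷ (opposite y₂∼v x₁≁v ∷ F-irreflexive (F-flip Fy₁y₂) ∷ opposite y₂∼v x₃≁v ∷ [])
             ∷ (x₁≢y₁ ∷ x₁≢x₃ ∷ [])
             ∷ (y₁≢x₃ ∷ [])
             ∷ [] ∷ []

-- Double counting

6+2t≤s : ∀ t s → 6 ≤ s → 4 * t ≤ s → (0 < t → 10 ≤ s) → 6 + 2 * t ≤ s
6+2t≤s zero                s 6≤s _     _       = 6≤s
6+2t≤s (suc zero)          s _   _     hit⇒10≤s = ≤-trans (m≤m+n 8 2) (hit⇒10≤s z<s)
6+2t≤s (suc (suc zero))    s _   _     hit⇒10≤s = hit⇒10≤s z<s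
6+2t≤s t@(suc (suc (suc r))) s _ 4t≤s  _       = begin
  2 * 3 + 2 * t    ≤⟨ +-monoˡ-≤ (2 * t) (*-monoʳ-≤ 2 (m≤m+n 3 r)) ⟩
  2 * t + 2 * t    ≡⟨ *-distribʳ-+ t 2 2 ⟨
  4 * t            ≤⟨ 4t≤s ⟩
  s                ∎
  where open ≤-Reasoning

eighth-split : ∀ n k₁ k₂ → 6 * k₂ + 2 * k₁ ≤ n → 8 * k₁ ≤ n ⊎ 8 * k₂ ≤ n
eighth-split n k₁ k₂ bound with 8 * k₁ ≤? n | 8 * k₂ ≤? n
... | yes 8k₁≤n | _         = inj₁ 8k₁≤n
... | no _      | yes 8k₂≤n = inj₂ 8k₂≤n
... | no 8k₁≰n  | no 8k₂≰n  = contradiction (*-monoʳ-≤ 8 bound) (<⇒≱ (begin-strict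
  8 * n                            ≡⟨ *-distribʳ-+ n 6 2 ⟩
  6 * n + 2 * n                    <⟨ +-mono-< (*-monoʳ-< 6 (≰⇒> 8k₂≰n)) (*-monoʳ-< 2 (≰⇒> 8k₁≰n)) ⟩
  6 * (8 * k₂) + 2 * (8 * k₁)      ≡⟨ regroup k₁ k₂ ⟩
  8 * (6 * k₂ + 2 * k₁)            ∎))
  where
  open ≤-Reasoning
  regroup : ∀ a b → 6 * (8 * b) + 2 * (8 * a) ≡ 8 * (6 * b + 2 * a)
  regroup = solve-∀

module DoubleCounting {n : ℕ} (F₁ F₂ : Rel n) (F₁-sym : Symmetric F₁) (F₂-sym : Symmetric F₂)
  (F₂-components≥6 : ∀ D → 6 ≤ size (Reachability.Conn? F₂ D))
  (assignment : ∀ c → ∃ λ d → ComponentSize≥ F₂ d 10 × IntersectionSize≥ F₁ c F₂ d 4) where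

  module C₁ = Components F₁ F₁-sym
  module C₂ = Components F₂ F₂-sym

  -- An F₁-cycle C is represented by any of its nodes c; partner c is D(C), and common c lists
  -- four distinct nodes of C ∩ D(C).
  private
    partner : Fin n → Fin n
    partner c = proj₁ (assignment c)
    common : Fin n → Fin 4 → Fin n
    common c = proj₁ (proj₂ (proj₂ (assignment c)))
    common-injective : ∀ c → Injective _≡_ _≡_ (common c)
    common-injective c = proj₁ (proj₂ (proj₂ (proj₂ (assignment c))))
    common∈C₁ : ∀ c i → Conn F₁ c (common c i)
    common∈C₁ c i = proj₁ (proj₂ (proj₂ (proj₂ (proj₂ (assignment c)))) i)
    common∈C₂ : ∀ c i → Conn F₂ (partner c) (common c i)
    common∈C₂ c i = proj₂ (proj₂ (proj₂ (proj₂ (proj₂ (assignment c)))) i)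
    partner-big : ∀ c → 10 ≤ size (C₂.Conn? (partner c))
    partner-big c with proj₁ (proj₂ (assignment c))
    ... | e , e-injective , e∈C₂ = injective⇒≤size (C₂.Conn? (partner c)) e-injective e∈C₂

  private
    ℓ₁ : Fin n → ℕ
    ℓ₁ c = ⟦ C₁.leader? c ⟧
    ℓ₂ : Fin n → ℕ
    ℓ₂ D = ⟦ C₂.leader? D ⟧
    χ : Fin n → Fin n → ℕ
    χ D v = ⟦ C₂.Conn? D v ⟧

  load : Fin n → ℕ
  load v = ∑[ c < n ] (ℓ₁ c * multiplicity (common c) v)

  load≤1 : ∀ v → load v ≤ 1
  load≤1 v =
    ∑-≤1 (λ c → *-mono-≤ (⟦⟧≤1 (C₁.leader? c)) (multiplicity≤1 (common-injective c) v)) unique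
    where
    unique : ∀ c c′ → 0 < ℓ₁ c * multiplicity (common c) v →
             0 < ℓ₁ c′ * multiplicity (common c′) v → c ≡ c′
    unique c c′ p p′ with ⟦⟧*-pos (C₁.leader? c) p | ⟦⟧*-pos (C₁.leader? c′) p′
    ... | Lc , q | Lc′ , q′ with multiplicity-pos (common c) q | multiplicity-pos (common c′) q′
    ...   | i , cᵢ≡v | j , c′ⱼ≡v = C₁.leader-unique Lc Lc′
            (Conn-trans (subst (Conn F₁ c) cᵢ≡v (common∈C₁ c i))
                        (Conn-sym F₁-sym (subst (Conn F₁ c′) c′ⱼ≡v (common∈C₁ c′ j))))

  hits : Fin n → ℕ
  hits D = ∑[ c < n ] (ℓ₁ c * χ D (partner c))

  points-in-component : ∀ D c → ∑[ v < n ] (χ D v * multiplicity (common c) v) ≡ 4 * χ D (partner c)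
  points-in-component D c = begin
    ∑[ v < n ] (χ D v * multiplicity (common c) v)
      ≡⟨ ∑-*-multiplicity (common c) (χ D) ⟩
    ∑[ i < 4 ] χ D (common c i)
      ≡⟨ sum-cong-≗ {4} (λ i → C₂.Conn?-resp D (common∈C₂ c i)) ⟨
    ∑[ i < 4 ] χ D (partner c)
      ≡⟨ ∑-const 4 (χ D (partner c)) ⟩
    4 * χ D (partner c)
      ∎
    where open ≡-Reasoning

  load-in-component : ∀ D → ∑[ v < n ] (χ D v * load v) ≡ 4 * hits D
  load-in-component D = begin
    ∑[ v < n ] (χ D v * load v)
      ≡⟨ ∑-comm-weighted (χ D) ℓ₁ (λ v c → multiplicity (common c) v) ⟩
    ∑[ c < n ] (ℓ₁ c * ∑[ v < n ] (χ D v * multiplicity (common c) v))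
      ≡⟨ sum-cong-≗ {n} (λ c → cong (ℓ₁ c *_) (points-in-component D c)) ⟩
    ∑[ c < n ] (ℓ₁ c * (4 * χ D (partner c)))
      ≡⟨ sum-cong-≗ {n} (λ c → x∙yz≈y∙xz (ℓ₁ c) 4 (χ D (partner c))) ⟩
    ∑[ c < n ] (4 * (ℓ₁ c * χ D (partner c)))
      ≡⟨ *-distribˡ-sum 4 (λ c → ℓ₁ c * χ D (partner c)) ⟨
    4 * hits D
      ∎
    where open ≡-Reasoning

  4hits≤size : ∀ D → 4 * hits D ≤ size (C₂.Conn? D)
  4hits≤size D = begin
    4 * hits D                    ≡⟨ load-in-component D ⟨
    ∑[ v < n ] (χ D v * load v)   ≤⟨ ∑-mono-≤ (λ v → *-monoʳ-≤ (χ D v) (load≤1 v)) ⟩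
    ∑[ v < n ] (χ D v * 1)        ≡⟨ sum-cong-≗ {n} (λ v → *-identityʳ (χ D v)) ⟩
    size (C₂.Conn? D)             ∎
    where open ≤-Reasoning

  hit⇒10≤size : ∀ D → 0 < hits D → 10 ≤ size (C₂.Conn? D)
  hit⇒10≤size D 0<hits with ∑-pos (λ c → ℓ₁ c * χ D (partner c)) 0<hits
  ... | c , p with ⟦⟧*-pos (C₁.leader? c) p
  ...   | _ , q = ≤-trans (partner-big c) (size-mono (C₂.Conn? (partner c)) (C₂.Conn? D) partner⊆D)
    where
    partner⊆D : ∀ {v} → Conn F₂ (partner c) v → Conn F₂ D v
    partner⊆D = Conn-trans (⟦⟧-pos (C₂.Conn? D (partner c)) q)

  ∑-hits : ∑[ D < n ] (ℓ₂ D * hits D) ≡ C₁.#components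
  ∑-hits = begin
    ∑[ D < n ] (ℓ₂ D * hits D)
      ≡⟨ ∑-comm-weighted ℓ₂ ℓ₁ (λ D c → χ D (partner c)) ⟩
    ∑[ c < n ] (ℓ₁ c * ∑[ D < n ] (ℓ₂ D * χ D (partner c)))
      ≡⟨ sum-cong-≗ {n} (λ c → cong (ℓ₁ c *_) (C₂.one-leader (partner c))) ⟩
    ∑[ c < n ] (ℓ₁ c * 1)
      ≡⟨ sum-cong-≗ {n} (λ c → *-identityʳ (ℓ₁ c)) ⟩
    C₁.#components
      ∎
    where open ≡-Reasoning

  components-bound : 6 * C₂.#components + 2 * C₁.#components ≤ n
  components-bound = begin
    6 * C₂.#components + 2 * C₁.#components
      ≡⟨ cong₂ _+_ (*-distribˡ-sum 6 ℓ₂)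
                   (trans (cong (2 *_) (sym ∑-hits)) (*-distribˡ-sum 2 (λ D → ℓ₂ D * hits D))) ⟩
    ∑[ D < n ] (6 * ℓ₂ D) + ∑[ D < n ] (2 * (ℓ₂ D * hits D))
      ≡⟨ ∑-distrib-+ (λ D → 6 * ℓ₂ D) (λ D → 2 * (ℓ₂ D * hits D)) ⟨
    ∑[ D < n ] (6 * ℓ₂ D + 2 * (ℓ₂ D * hits D))
      ≡⟨ sum-cong-≗ {n} (λ D → factor (ℓ₂ D) (hits D)) ⟩
    ∑[ D < n ] (ℓ₂ D * (6 + 2 * hits D))
      ≤⟨ ∑-mono-≤ (λ D → *-monoʳ-≤ (ℓ₂ D)
           (6+2t≤s (hits D) _ (F₂-components≥6 D) (4hits≤size D) (hit⇒10≤size D))) ⟩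
    ∑[ D < n ] (ℓ₂ D * size (C₂.Conn? D))
      ≡⟨ C₂.∑-component-sizes ⟩
    n ∎
    where
    open ≤-Reasoning
    factor : ∀ a h → 6 * a + 2 * (a * h) ≡ a * (6 + 2 * h)
    factor = solve-∀

lemma2 : {n : ℕ} (E F₁ F₂ : Rel n) →
    IsSimpleGraph E → IsCubic E → IsBipartite E →
    ¬ HasPotential4Cycle E →
    IsTwoFactor E F₁ → IsTwoFactor E F₂ →
    (∀ (c : Fin n) → ∃ λ (d : Fin n) →
        ComponentSize≥ F₂ d 10 × IntersectionSize≥ F₁ c F₂ d 4) →
    AtMostEighthComponents F₁ ⊎ AtMostEighthComponents F₂
lemma2 E F₁ F₂ (_ , E-loopless) _ bipartite no-square F₁-twoFactor F₂-twoFactor assignment =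
  Sum.map (λ 8k₁≤n → C₁.#components , 8k₁≤n , C₁.atMostComponents)
          (λ 8k₂≤n → C₂.#components , 8k₂≤n , C₂.atMostComponents)
          (eighth-split _ C₁.#components C₂.#components components-bound)
  where
  open DoubleCounting F₁ F₂ (proj₁ F₁-twoFactor) (proj₁ F₂-twoFactor)
         (TwoFactor.component-size≥6 E-loopless bipartite F₂-twoFactor no-square) assignment
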